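{- Let $G$ be a pseudo-outerplanar graph. Then (a) $\delta(G)\leq 3$; and (b) $\kappa(G)\leq 2$ unless $G\cong K_4$.
   Context: All graphs are finite, simple and undirected. A block is a maximal 2-connected subgraph; bridges are blocks too. A graph is pseudo-outerplanar if each of its blocks can be drawn in the plane so that its vertices lie on a fixed circle, its edges lie inside the disk bounded by that circle, and each edge crosses at most one other edge. $\delta(G)$ is the minimum degree of $G$. $\kappa(G)$ is the vertex connectivity: the minimum number of vertices whose deletion disconnects $G$. -}

module Defs where

open import Data.Nat using (ℕ; _≤_; _<_)
open import Data.Fin using (Fin)
open import Data.Fin.Subset using (Subset; _∈_; _⊂_; ∁; _-_; ∣_∣)
open import Data.Bool using (Bool; true; false)
open import Data.Vec using (tabulate)
open import Data.Product using (Σ; _×_; ∃)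
open import Data.Sum using (_⊎_)
open import Relation.Binary.PropositionalEquality using (_≡_; refl) renaming (sym to sym′)
open import Data.Fin using (_≟_)
open import Data.Bool using (not)
open import Relation.Nullary using (yes; no)
open import Relation.Nullary.Decidable using (⌊_⌋)
open import Data.Empty using (⊥-elim)
open import Relation.Nullary using (¬_)
open import Function.Bundles using (_⤖_; Bijection)

record Graph (n : ℕ) : Set where
  field
    adj    : Fin n → Fin n → Bool
    sym    : ∀ u v → adj u v ≡ adj v u
    irrefl : ∀ v → adj v v ≡ false
open Graph public

module _ {n : ℕ} (G : Graph n) where

  degree : Fin n → ℕ
  degree v = ∣ tabulate (adj G v) ∣

  MinDegree≤ : ℕ → Set
  MinDegree≤ k = ∃ λ v → degree v ≤ k

  data Walk (S : Subset n) : Fin n → Fin n → Set where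
    here : ∀ {u} → Walk S u u
    step : ∀ {u w v} → adj G u w ≡ true → w ∈ S → Walk S w v → Walk S u v

  Connected : Subset n → Set
  Connected S = ∀ u v → u ∈ S → v ∈ S → Walk S u v

  -- G[B] is 2-connected or is K2 (a bridge), i.e. a nonseparable graph
  -- on at least 2 vertices
  Nonseparable : Subset n → Set
  Nonseparable B = 2 ≤ ∣ B ∣ × Connected B × (∀ v → v ∈ B → Connected (B - v))

  IsBlock : Subset n → Set
  IsBlock B = Nonseparable B × (∀ B′ → B ⊂ B′ → ¬ Nonseparable B′)

  -- Drawing of G[B] with vertices on a circle: vertices of B receive
  -- distinct positions (a cyclic order, cut at some point).  Two chords
  -- ab and cd cross iff exactly one of c, d lies strictly between a and b
  -- and the other strictly outside.
  module _ (pos : Fin n → ℕ) where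
    Between : Fin n → Fin n → Fin n → Set
    Between x y z = (pos x < pos y × pos y < pos z) ⊎ (pos z < pos y × pos y < pos x)

    Outside : Fin n → Fin n → Fin n → Set
    Outside x y z = (pos y < pos x × pos y < pos z) ⊎ (pos x < pos y × pos z < pos y)

    Cross : Fin n → Fin n → Fin n → Fin n → Set
    Cross a b c d = (Between a c b × Outside a d b) ⊎ (Outside a c b × Between a d b)

  IsEdgeIn : Subset n → Fin n → Fin n → Set
  IsEdgeIn B a b = a ∈ B × b ∈ B × adj G a b ≡ true

  OuterOneDrawable : Subset n → Set
  OuterOneDrawable B =
    Σ (Fin n → ℕ) λ pos →
      (∀ x y → x ∈ B → y ∈ B → pos x ≡ pos y → x ≡ y) ×
      (∀ a b c d c′ d′ → IsEdgeIn B a b → IsEdgeIn B c d → IsEdgeIn B c′ d′ →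
         Cross pos a b c d → Cross pos a b c′ d′ →
         (c ≡ c′ × d ≡ d′) ⊎ (c ≡ d′ × d ≡ c′))

  PseudoOuterplanar : Set
  PseudoOuterplanar = ∀ B → IsBlock B → OuterOneDrawable B

  -- κ(G) ≤ k: some set S of at most k vertices whose deletion leaves a
  -- disconnected graph or a graph with at most one vertex
  -- (standard convention, giving κ(Kₙ) = n - 1)
  Connectivity≤ : ℕ → Set
  Connectivity≤ k = ∃ λ (S : Subset n) →
    ∣ S ∣ ≤ k × (¬ Connected (∁ S) ⊎ ∣ ∁ S ∣ ≤ 1)

_≅_ : ∀ {n m} → Graph n → Graph m → Set
_≅_ {n} {m} G H = Σ (Fin n ⤖ Fin m) λ f →
  ∀ u v → adj G u v ≡ adj H (Bijection.to f u) (Bijection.to f v)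

complete : (m : ℕ) → Graph m
complete m = record { adj = λ u v → not ⌊ u ≟ v ⌋ ; sym = csym ; irrefl = cirr }
  where
  csym : ∀ u v → not ⌊ u ≟ v ⌋ ≡ not ⌊ v ≟ u ⌋
  csym u v with u ≟ v | v ≟ u
  ... | yes _ | yes _ = refl
  ... | no _  | no _  = refl
  ... | yes p | no q  = ⊥-elim (q (sym′ p))
  ... | no p  | yes q = ⊥-elim (p (sym′ q))
  cirr : ∀ v → not ⌊ v ≟ v ⌋ ≡ false
  cirr v with v ≟ v
  ... | yes _ = refl
  ... | no p  = ⊥-elim (p refl)

K4 : Graph 4
K4 = complete 4

-- (a) If every degree is at least 4, start from the whole graph and repeatedly pass to a
-- component, or to a lobe at a cut vertex, keeping a set X that meets the rest of G in at most one
-- vertex c.  This ends at a block X with that property.  Rotate its one-crossing circular drawing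
-- so that c comes first and take a shortest chord ab with a vertex w strictly between a and b.
-- Then w is not c, so all neighbours of w lie in X.  An edge from w to a vertex between a and b
-- is shorter than ab, so it covers no vertex: there are at most two such neighbours, the ones
-- next to w.  Every other edge at w crosses ab, and ab is crossed at most once, so deg w ≤ 3.
--
-- (b) Suppose G is 3-connected on at least 5 vertices; then G is a block.  In the shortest chord
-- ab with an inner vertex, every inner vertex has degree at least 3, so it has an edge crossing
-- ab.  As ab is crossed only once, w is its only inner vertex and its neighbours are a, b and the
-- far end x of the crossing edge.  Then {b, x} or {a, x} separates G.  A 3-connected graph on
-- 4 vertices is K4; on at most 3 vertices, deleting all but one vertex already witnesses κ ≤ 2.

module Submission where

open import Defs
open import Data.Bool using (Bool; true; false) renaming (_≟_ to _≟ᵇ_)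
open import Data.Empty using (⊥; ⊥-elim)
open import Data.Fin using (Fin; zero; suc; fromℕ<) renaming (_≟_ to _≟ᶠ_)
open import Data.Fin.Properties using (any?; all?)
open import Data.Fin.Subset renaming (⊥ to ∅)
open import Data.Fin.Subset.Properties
open import Data.Nat using (ℕ; zero; suc; _+_; _∸_; _≤_; _<_; z≤n; s≤s; _<?_; _≤?_)
open import Data.Nat.Induction using (<-wellFounded)
open import Data.Nat.Properties
open import Data.Product using (_×_; _,_; proj₁; proj₂; ∃; ∃₂; uncurry)
import Data.Product as Product
open import Data.Sum using (_⊎_; inj₁; inj₂; [_,_]′)
import Data.Sum as Sum
open import Data.Vec using (_∷_; []; tabulate; here; there)
open import Data.Vec.Properties using (lookup∘tabulate; []=⇒lookup; lookup⇒[]=)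
open import Function using (_∘_)
open import Function.Construct.Identity using (⤖-id)
open import Induction.WellFounded using (Acc; acc)
open import Relation.Binary using (tri<; tri≈; tri>)
open import Relation.Binary.PropositionalEquality
  using (_≡_; _≢_; refl; trans; cong; cong₂; subst) renaming (sym to ≡-sym)
open import Relation.Nullary using (¬_; Dec; yes; no; does; isYes; contradiction)
open import Relation.Nullary.Decidable using (decidable-stable; dec-true; _×-dec_; _⊎-dec_; _→-dec_; ¬?; map′)

private variable
  n : ℕ

-- Finite sets of vertices

∣p∪q∣≤∣p∣+∣q∣ : (p q : Subset n) → ∣ p ∪ q ∣ ≤ ∣ p ∣ + ∣ q ∣
∣p∪q∣≤∣p∣+∣q∣ []          []          = z≤n
∣p∪q∣≤∣p∣+∣q∣ (true  ∷ p) (true  ∷ q) = s≤s (≤-trans (∣p∪q∣≤∣p∣+∣q∣ p q) (+-monoʳ-≤ ∣ p ∣ (n≤1+n _)))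
∣p∪q∣≤∣p∣+∣q∣ (true  ∷ p) (false ∷ q) = s≤s (∣p∪q∣≤∣p∣+∣q∣ p q)
∣p∪q∣≤∣p∣+∣q∣ (false ∷ p) (true  ∷ q) = subst (suc ∣ p ∪ q ∣ ≤_) (≡-sym (+-suc ∣ p ∣ ∣ q ∣)) (s≤s (∣p∪q∣≤∣p∣+∣q∣ p q))
∣p∪q∣≤∣p∣+∣q∣ (false ∷ p) (false ∷ q) = ∣p∪q∣≤∣p∣+∣q∣ p q

∣⁅x⁆∪⁅y⁆∣≤2 : (x y : Fin n) → ∣ ⁅ x ⁆ ∪ ⁅ y ⁆ ∣ ≤ 2
∣⁅x⁆∪⁅y⁆∣≤2 x y = subst (∣ ⁅ x ⁆ ∪ ⁅ y ⁆ ∣ ≤_) (cong₂ _+_ (∣⁅x⁆∣≡1 x) (∣⁅x⁆∣≡1 y)) (∣p∪q∣≤∣p∣+∣q∣ ⁅ x ⁆ ⁅ y ⁆)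

x∈p─q⇒x∉q : ∀ (p q : Subset n) {x} → x ∈ p ─ q → x ∉ q
x∈p─q⇒x∉q (s ∷ p) (true  ∷ q) {zero}  ()        here
x∈p─q⇒x∉q (s ∷ p) (false ∷ q) {zero}  _         ()
x∈p─q⇒x∉q (s ∷ p) (t     ∷ q) {suc x} (there m) (there m′) = x∈p─q⇒x∉q p q m m′

x∈p-y⇒x≢y : ∀ {p : Subset n} {x y} → x ∈ p - y → x ≢ y
x∈p-y⇒x≢y {p = p} {y = y} m = x∉⁅y⁆⇒x≢y (x∈p─q⇒x∉q p ⁅ y ⁆ m)

x∈∁⁅y⁆∪⁅z⁆⁺ : ∀ {x y z : Fin n} → x ≢ y → x ≢ z → x ∈ ∁ (⁅ y ⁆ ∪ ⁅ z ⁆)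
x∈∁⁅y⁆∪⁅z⁆⁺ {y = y} {z = z} x≢y x≢z =
  x∉p⇒x∈∁p λ x∈ → [ x≢y ∘ x∈⁅y⁆⇒x≡y y , x≢z ∘ x∈⁅y⁆⇒x≡y z ]′ (x∈p∪q⁻ ⁅ y ⁆ ⁅ z ⁆ x∈)

x∈∁⁅y⁆∪⁅z⁆⁻ : ∀ {x y z : Fin n} → x ∈ ∁ (⁅ y ⁆ ∪ ⁅ z ⁆) → x ≢ y × x ≢ z
x∈∁⁅y⁆∪⁅z⁆⁻ x∈ = (λ { refl → x∈∁p⇒x∉p x∈ (x∈p∪q⁺ (inj₁ (x∈⁅x⁆ _))) }) ,
                  (λ { refl → x∈∁p⇒x∉p x∈ (x∈p∪q⁺ (inj₂ (x∈⁅x⁆ _))) })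

x∈p⇒1≤∣p∣ : ∀ {x} {p : Subset n} → x ∈ p → 1 ≤ ∣ p ∣
x∈p⇒1≤∣p∣ {x = x} {p} x∈p = subst (_≤ ∣ p ∣) (∣⁅x⁆∣≡1 x)
  (p⊆q⇒∣p∣≤∣q∣ λ y∈⁅x⁆ → subst (_∈ p) (≡-sym (x∈⁅y⁆⇒x≡y x y∈⁅x⁆)) x∈p)

x≢y⇒2≤∣p∣ : ∀ {x y} {p : Subset n} → x ∈ p → y ∈ p → x ≢ y → 2 ≤ ∣ p ∣
x≢y⇒2≤∣p∣ x∈p y∈p x≢y =
  ≤-trans (s≤s (x∈p⇒1≤∣p∣ (x∈p∧x≢y⇒x∈p-y y∈p (λ y≡x → x≢y (≡-sym y≡x))))) (x∈p⇒∣p-x∣<∣p∣ x∈p)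

1≤∣p∣⇒nonempty : (p : Subset n) → 1 ≤ ∣ p ∣ → Nonempty p
1≤∣p∣⇒nonempty {n} p 1≤∣p∣ with nonempty? p
... | yes ne = ne
... | no ¬ne = contradiction (trans (cong ∣_∣ (Empty-unique ¬ne)) (∣⊥∣≡0 n)) (>⇒≢ 1≤∣p∣)

∣p∣≤1 : (p : Subset n) → (∀ {x y} → x ∈ p → y ∈ p → x ≡ y) → ∣ p ∣ ≤ 1
∣p∣≤1 {n} p unique with nonempty? p
... | yes (x , x∈p) = subst (∣ p ∣ ≤_) (∣⁅x⁆∣≡1 x)
  (p⊆q⇒∣p∣≤∣q∣ λ y∈p → subst (_∈ ⁅ x ⁆) (unique x∈p y∈p) (x∈⁅x⁆ x))
... | no ¬ne = ≤-trans (≤-reflexive (trans (cong ∣_∣ (Empty-unique ¬ne)) (∣⊥∣≡0 n))) z≤n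

∣p∣<n⇒∃∉ : (p : Subset n) → ∣ p ∣ < n → ∃ λ x → x ∉ p
∣p∣<n⇒∃∉ p ∣p∣<n =
  let x , x∈∁p = 1≤∣p∣⇒nonempty (∁ p) (subst (1 ≤_) (≡-sym (∣∁p∣≡n∸∣p∣ p)) (m<n⇒0<n∸m ∣p∣<n))
  in x , x∈∁p⇒x∉p x∈∁p

fifth-vertex : 5 ≤ n → (a b c d : Fin n) → ∃ λ w → w ≢ a × w ≢ b × w ≢ c × w ≢ d
fifth-vertex 5≤n a b c d with ∣p∣<n⇒∃∉ abcd (<-≤-trans (s≤s ∣abcd∣≤4) 5≤n)
  where
  abcd = (⁅ a ⁆ ∪ ⁅ b ⁆) ∪ (⁅ c ⁆ ∪ ⁅ d ⁆)
  ∣abcd∣≤4 : ∣ abcd ∣ ≤ 4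
  ∣abcd∣≤4 = ≤-trans (∣p∪q∣≤∣p∣+∣q∣ (⁅ a ⁆ ∪ ⁅ b ⁆) (⁅ c ⁆ ∪ ⁅ d ⁆))
                     (+-mono-≤ (∣⁅x⁆∪⁅y⁆∣≤2 a b) (∣⁅x⁆∪⁅y⁆∣≤2 c d))
... | w , w∉ = w , (λ { refl → w∉ (p⊆p∪q (⁅ c ⁆ ∪ ⁅ d ⁆) (p⊆p∪q ⁅ b ⁆ (x∈⁅x⁆ w))) }) ,
                   (λ { refl → w∉ (p⊆p∪q (⁅ c ⁆ ∪ ⁅ d ⁆) (q⊆p∪q ⁅ a ⁆ ⁅ b ⁆ (x∈⁅x⁆ w))) }) ,
                   (λ { refl → w∉ (q⊆p∪q (⁅ a ⁆ ∪ ⁅ b ⁆) _ (p⊆p∪q ⁅ d ⁆ (x∈⁅x⁆ w))) }) ,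
                   (λ { refl → w∉ (q⊆p∪q (⁅ a ⁆ ∪ ⁅ b ⁆) _ (q⊆p∪q ⁅ c ⁆ ⁅ d ⁆ (x∈⁅x⁆ w))) })

2≤∣p∣⇒∃≢ : (p : Subset n) (x : Fin n) → 2 ≤ ∣ p ∣ → ∃ λ y → y ∈ p × y ≢ x
2≤∣p∣⇒∃≢ p x 2≤∣p∣ with 1≤∣p∣⇒nonempty (p - x) 1≤∣p-x∣
  where
  p⊆p-x∪x : p ⊆ (p - x) ∪ ⁅ x ⁆
  p⊆p-x∪x {y} y∈p with y ≟ᶠ x
  ... | yes refl = x∈p∪q⁺ (inj₂ (x∈⁅x⁆ y))
  ... | no y≢x   = x∈p∪q⁺ (inj₁ (x∈p∧x≢y⇒x∈p-y y∈p y≢x))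
  1≤∣p-x∣ : 1 ≤ ∣ p - x ∣
  1≤∣p-x∣ = +-cancelʳ-≤ 1 1 ∣ p - x ∣ (begin
    2                             ≤⟨ 2≤∣p∣ ⟩
    ∣ p ∣                         ≤⟨ p⊆q⇒∣p∣≤∣q∣ p⊆p-x∪x ⟩
    ∣ (p - x) ∪ ⁅ x ⁆ ∣           ≤⟨ ∣p∪q∣≤∣p∣+∣q∣ (p - x) ⁅ x ⁆ ⟩
    ∣ p - x ∣ + ∣ ⁅ x ⁆ ∣         ≡⟨ cong (∣ p - x ∣ +_) (∣⁅x⁆∣≡1 x) ⟩
    ∣ p - x ∣ + 1                 ∎)
    where open ≤-Reasoning
... | y , y∈p-x = y , p─q⊆p p ⁅ x ⁆ y∈p-x , x∈p-y⇒x≢y y∈p-x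

⟦_⟧ : {P : Fin n → Set} → (∀ x → Dec (P x)) → Subset n
⟦ P? ⟧ = tabulate (λ x → does (P? x))

∈tabulate⁺ : (f : Fin n → Bool) {x : Fin n} → f x ≡ true → x ∈ tabulate f
∈tabulate⁺ f {x} fx = lookup⇒[]= x _ (trans (lookup∘tabulate f x) fx)

∈tabulate⁻ : (f : Fin n → Bool) {x : Fin n} → x ∈ tabulate f → f x ≡ true
∈tabulate⁻ f {x} x∈ = trans (≡-sym (lookup∘tabulate f x)) ([]=⇒lookup x∈)

∈⟦⟧⁺ : {P : Fin n → Set} (P? : ∀ x → Dec (P x)) {x : Fin n} → P x → x ∈ ⟦ P? ⟧
∈⟦⟧⁺ P? {x} px = ∈tabulate⁺ _ (dec-true (P? x) px)

∈⟦⟧⁻ : {P : Fin n → Set} (P? : ∀ x → Dec (P x)) {x : Fin n} → x ∈ ⟦ P? ⟧ → P x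
∈⟦⟧⁻ P? {x} x∈ with P? x | ∈tabulate⁻ _ {x} x∈
... | yes px | _ = px

-- Walks and components

module _ {n : ℕ} (G : Graph n) where

  adj⇒≢ : ∀ {u v} → adj G u v ≡ true → u ≢ v
  adj⇒≢ {u} uv refl with trans (≡-sym (irrefl G u)) uv
  ... | ()

  walk-mono : ∀ {S T u v} → S ⊆ T → Walk G S u v → Walk G T u v
  walk-mono S⊆T here            = here
  walk-mono S⊆T (step e w∈S wk) = step e (S⊆T w∈S) (walk-mono S⊆T wk)

  walk-snoc : ∀ {S u v w} → Walk G S u v → adj G v w ≡ true → w ∈ S → Walk G S u w
  walk-snoc here             e w∈S = step e w∈S here
  walk-snoc (step e′ z∈S wk) e w∈S = step e′ z∈S (walk-snoc wk e w∈S)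

  walk-++ : ∀ {S u v w} → Walk G S u v → Walk G S v w → Walk G S u w
  walk-++ here            wk′ = wk′
  walk-++ (step e z∈S wk) wk′ = step e z∈S (walk-++ wk wk′)

  walk-reverse : ∀ {S u v} → u ∈ S → Walk G S u v → Walk G S v u
  walk-reverse u∈S here                       = here
  walk-reverse {u = u} u∈S (step {w = w} e w∈S wk) =
    walk-snoc (walk-reverse w∈S wk) (trans (sym G w u) e) u∈S

  walk-end∈ : ∀ {S u v} → u ∈ S → Walk G S u v → v ∈ S
  walk-end∈ u∈S here            = u∈S
  walk-end∈ u∈S (step e w∈S wk) = walk-end∈ w∈S wk

  walk-preserves : ∀ {S} (P : Fin n → Set) → (∀ z y → P z → adj G z y ≡ true → y ∈ S → P y) →
                   ∀ {u v} → P u → Walk G S u v → P v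
  walk-preserves P spreads pu here                           = pu
  walk-preserves P spreads {u} pu (step {w = w} e w∈S wk) = walk-preserves P spreads (spreads u w pu e w∈S) wk

  record Component (S : Subset n) (u : Fin n) : Set where
    field
      members  : Subset n
      reached  : ∀ {z} → z ∈ members → Walk G S u z
      contains : ∀ {z} → Walk G S u z → z ∈ members

  private
    Frontier : Subset n → Subset n → Fin n → Set
    Frontier S R w = w ∈ S × w ∉ R × ∃ λ z → z ∈ R × adj G z w ≡ true

    frontier? : ∀ S R w → Dec (Frontier S R w)
    frontier? S R w = (w ∈? S) ×-dec ¬? (w ∈? R) ×-dec any? (λ z → (z ∈? R) ×-dec (adj G z w ≟ᵇ true))

    -- Each step adds a member to R, so fuel n suffices.
    grow : ∀ S u (fuel : ℕ) (R : Subset n) → n < ∣ R ∣ + fuel → (∀ {z} → z ∈ R → Walk G S u z) → u ∈ R →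
           Component S u
    grow S u fuel R bound reached u∈R with any? (frontier? S R)
    ... | no ¬frontier = record { members = R ; reached = reached ; contains = walk-preserves (_∈ R) closed u∈R }
      where
      closed : ∀ z y → z ∈ R → adj G z y ≡ true → y ∈ S → y ∈ R
      closed z y z∈R e y∈S with y ∈? R
      ... | yes y∈R = y∈R
      ... | no y∉R  = contradiction (y , y∈S , y∉R , z , z∈R , e) ¬frontier
    grow S u zero R bound reached u∈R | yes _ =
      contradiction (≤-trans bound (≤-trans (≤-reflexive (+-identityʳ _)) (∣p∣≤n R))) (<-irrefl refl)
    grow S u (suc fuel) R bound reached u∈R | yes (w , w∈S , w∉R , z , z∈R , e) =
      grow S u fuel (R ∪ ⁅ w ⁆) bound′ reached′ (p⊆p∪q ⁅ w ⁆ u∈R)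
      where
      bound′ : n < ∣ R ∪ ⁅ w ⁆ ∣ + fuel
      bound′ = ≤-trans bound (≤-trans (≤-reflexive (+-suc _ fuel))
                 (+-monoˡ-≤ fuel (p⊂q⇒∣p∣<∣q∣ (p⊆p∪q ⁅ w ⁆ , w , x∈p∪q⁺ (inj₂ (x∈⁅x⁆ w)) , w∉R))))
      reached′ : ∀ {y} → y ∈ R ∪ ⁅ w ⁆ → Walk G S u y
      reached′ {y} y∈ with x∈p∪q⁻ R ⁅ w ⁆ y∈
      ... | inj₁ y∈R = reached y∈R
      ... | inj₂ y∈⁅w⁆ rewrite x∈⁅y⁆⇒x≡y w y∈⁅w⁆ = walk-snoc (reached z∈R) e w∈S

  component : ∀ S u → Component S u
  component S u = grow S u n ⁅ u ⁆ (≤-reflexive (cong (_+ n) (≡-sym (∣⁅x⁆∣≡1 u))))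
    (λ z∈⁅u⁆ → subst (Walk G S u) (≡-sym (x∈⁅y⁆⇒x≡y u z∈⁅u⁆)) here) (x∈⁅x⁆ u)

  walk? : ∀ S u v → Dec (Walk G S u v)
  walk? S u v = map′ reached contains (v ∈? members)
    where open Component (component S u)

  Separated : Subset n → Set
  Separated S = ∃₂ λ u w → u ∈ S × w ∈ S × ¬ Walk G S u w

  separated? : ∀ S → Dec (Separated S)
  separated? S = any? λ u → any? λ w → (u ∈? S) ×-dec (w ∈? S) ×-dec ¬? (walk? S u w)

  ¬separated⇒connected : ∀ {S} → ¬ Separated S → Connected G S
  ¬separated⇒connected {S} ¬sep u w u∈S w∈S with walk? S u w
  ... | yes wk = wk
  ... | no ¬wk = contradiction (u , w , u∈S , w∈S , ¬wk) ¬sep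

  connected? : ∀ S → Dec (Connected G S)
  connected? S with separated? S
  ... | yes (u , w , u∈S , w∈S , ¬wk) = no λ conn → ¬wk (conn u w u∈S w∈S)
  ... | no ¬sep = yes (¬separated⇒connected ¬sep)

-- Circular drawings

bound : ∀ {n} → (Fin n → ℕ) → ℕ
bound {zero}  f = 0
bound {suc n} f = f zero + bound (f ∘ suc)

≤bound : ∀ {n} (f : Fin n → ℕ) i → f i ≤ bound f
≤bound f zero    = m≤m+n _ _
≤bound f (suc i) = ≤-trans (≤bound (f ∘ suc) i) (m≤n+m _ _)

module _ {n : ℕ} (G : Graph n) where

  between-sym : ∀ {p x y z} → Between G p x y z → Between G p z y x
  between-sym (inj₁ xyz) = inj₂ xyz
  between-sym (inj₂ zyx) = inj₁ zyx

  outside-sym : ∀ {p x y z} → Outside G p x y z → Outside G p z y x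
  outside-sym (inj₁ (yx , yz)) = inj₁ (yz , yx)
  outside-sym (inj₂ (xy , zy)) = inj₂ (zy , xy)

  ¬between×outside : ∀ {p x y z} → Between G p x y z → ¬ Outside G p x y z
  ¬between×outside (inj₁ (xy , yz)) (inj₁ (yx , _))  = <-asym xy yx
  ¬between×outside (inj₁ (xy , yz)) (inj₂ (_ , zy))  = <-asym yz zy
  ¬between×outside (inj₂ (zy , yx)) (inj₁ (_ , yz))  = <-asym zy yz
  ¬between×outside (inj₂ (zy , yx)) (inj₂ (xy , _)) = <-asym yx xy

  between? : ∀ p x y z → Dec (Between G p x y z)
  between? p x y z = ((p x <? p y) ×-dec (p y <? p z)) ⊎-dec ((p z <? p y) ×-dec (p y <? p x))

  outside? : ∀ p x y z → Dec (Outside G p x y z)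
  outside? p x y z = ((p y <? p x) ×-dec (p y <? p z)) ⊎-dec ((p x <? p y) ×-dec (p z <? p y))

  cross? : ∀ p a b c d → Dec (Cross G p a b c d)
  cross? p a b c d = (between? p a c b ×-dec outside? p a d b) ⊎-dec (outside? p a c b ×-dec between? p a d b)

  Injective-on : Subset n → (Fin n → ℕ) → Set
  Injective-on B p = ∀ x y → x ∈ B → y ∈ B → p x ≡ p y → x ≡ y

  SameEdge : Fin n → Fin n → Fin n → Fin n → Set
  SameEdge c d c′ d′ = (c ≡ c′ × d ≡ d′) ⊎ (c ≡ d′ × d ≡ c′)

  SameEdge-swap : ∀ {a b k z} → SameEdge a b k z → SameEdge b a k z
  SameEdge-swap = Sum.swap ∘ Sum.map Product.swap Product.swap

  CrossesAtMostOnce : Subset n → (Fin n → ℕ) → Set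
  CrossesAtMostOnce B p = ∀ a b c d c′ d′ → IsEdgeIn G B a b → IsEdgeIn G B c d → IsEdgeIn G B c′ d′ →
    Cross G p a b c d → Cross G p a b c′ d′ → SameEdge c d c′ d′

  -- q describes the same circular drawing as p, possibly rotated or reflected.
  Redraws : (p q : Fin n → ℕ) → Set
  Redraws p q = (∀ x y → q x ≡ q y → p x ≡ p y) × (∀ a b c d → Cross G q a b c d → Cross G p a b c d)

  redraw : ∀ {B p q} → Redraws p q → Injective-on B p × CrossesAtMostOnce B p →
           Injective-on B q × CrossesAtMostOnce B q
  redraw (q⇒p , cross⇒) (inj , once) =
    (λ x y x∈ y∈ e → inj x y x∈ y∈ (q⇒p x y e)) ,
    (λ a b c d c′ d′ ab cd cd′ cr cr′ → once a b c d c′ d′ ab cd cd′ (cross⇒ a b c d cr) (cross⇒ a b c′ d′ cr′))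

  -- q is p with the vertices of the arc g ≡ true moved, in order, behind all others.
  module Rotation (p q : Fin n → ℕ) (g : Fin n → Bool)
    (same-arc : ∀ x y → g x ≡ g y → q x < q y → p x < p y)
    (moved-first : ∀ x y → g x ≡ true → g y ≡ false → p x < p y)
    (moved-last : ∀ x y → g x ≡ true → g y ≡ false → q y < q x) where

    private
      along : ∀ {x y s} → g x ≡ s → g y ≡ s → q x < q y → p x < p y
      along gx gy = same-arc _ _ (trans gx (≡-sym gy))

      between-lower : ∀ a y b → q a < q y → q y < q b →
        (g a ≡ g b → Between G p a y b) × (g a ≢ g b → Outside G p a y b)
      between-lower a y b ay yb with g a in ga | g y in gy | g b in gb
      ... | true  | true  | true  = (λ _ → inj₁ (along ga gy ay , along gy gb yb)) , contradiction refl
      ... | false | false | false = (λ _ → inj₁ (along ga gy ay , along gy gb yb)) , contradiction refl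
      ... | true  | false | _     = ⊥-elim (<-asym ay (moved-last a y ga gy))
      ... | _     | true  | false = ⊥-elim (<-asym yb (moved-last y b gy gb))
      ... | false | true  | true  = (λ ()) , λ _ → inj₁ (moved-first y a gy ga , along gy gb yb)
      ... | false | false | true  = (λ ()) , λ _ → inj₂ (along ga gy ay , moved-first b y gb gy)

      outside-lower : ∀ a y b → q y < q a → q y < q b →
        (g a ≡ g b → Outside G p a y b) × (g a ≢ g b → Between G p a y b)
      outside-lower a y b ya yb with g a in ga | g y in gy | g b in gb
      ... | true  | true  | true  = (λ _ → inj₁ (along gy ga ya , along gy gb yb)) , contradiction refl
      ... | false | false | false = (λ _ → inj₁ (along gy ga ya , along gy gb yb)) , contradiction refl
      ... | true  | false | true  = (λ _ → inj₂ (moved-first a y ga gy , moved-first b y gb gy)) , contradiction refl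
      ... | false | true  | false = (λ _ → inj₁ (moved-first y a gy ga , moved-first y b gy gb)) , contradiction refl
      ... | _     | true  | false = ⊥-elim (<-asym yb (moved-last y b gy gb))
      ... | false | true  | _     = ⊥-elim (<-asym ya (moved-last y a gy ga))
      ... | true  | false | false = (λ ()) , λ _ → inj₁ (moved-first a y ga gy , along gy gb yb)
      ... | false | false | true  = (λ ()) , λ _ → inj₂ (moved-first b y gb gy , along gy ga ya)

      outside-upper : ∀ a y b → q a < q y → q b < q y →
        (g a ≡ g b → Outside G p a y b) × (g a ≢ g b → Between G p a y b)
      outside-upper a y b ay by with g a in ga | g y in gy | g b in gb
      ... | true  | true  | true  = (λ _ → inj₂ (along ga gy ay , along gb gy by)) , contradiction refl
      ... | false | false | false = (λ _ → inj₂ (along ga gy ay , along gb gy by)) , contradiction refl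
      ... | true  | false | _     = ⊥-elim (<-asym ay (moved-last a y ga gy))
      ... | _     | false | true  = ⊥-elim (<-asym by (moved-last b y gb gy))
      ... | false | true  | false = (λ _ → inj₁ (moved-first y a gy ga , moved-first y b gy gb)) , contradiction refl
      ... | true  | true  | false = (λ ()) , λ _ → inj₁ (along ga gy ay , moved-first y b gy gb)
      ... | false | true  | true  = (λ ()) , λ _ → inj₂ (along gb gy by , moved-first y a gy ga)

      between⇒ : ∀ a y b → Between G q a y b →
        (g a ≡ g b → Between G p a y b) × (g a ≢ g b → Outside G p a y b)
      between⇒ a y b (inj₁ (ay , yb)) = between-lower a y b ay yb
      between⇒ a y b (inj₂ (by , ya)) with between-lower b y a by ya
      ... | same , differ = (λ e → between-sym {p = p} (same (≡-sym e))) ,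
                            (λ ne → outside-sym {p = p} (differ (ne ∘ ≡-sym)))

      outside⇒ : ∀ a y b → Outside G q a y b →
        (g a ≡ g b → Outside G p a y b) × (g a ≢ g b → Between G p a y b)
      outside⇒ a y b (inj₁ (ya , yb)) = outside-lower a y b ya yb
      outside⇒ a y b (inj₂ (ay , by)) = outside-upper a y b ay by

    cross⇒ : ∀ a b c d → Cross G q a b c d → Cross G p a b c d
    cross⇒ a b c d cr with g a ≟ᵇ g b
    cross⇒ a b c d (inj₁ (bc , od)) | yes e  = inj₁ (proj₁ (between⇒ a c b bc) e , proj₁ (outside⇒ a d b od) e)
    cross⇒ a b c d (inj₂ (oc , bd)) | yes e  = inj₂ (proj₁ (outside⇒ a c b oc) e , proj₁ (between⇒ a d b bd) e)
    cross⇒ a b c d (inj₁ (bc , od)) | no ne = inj₂ (proj₂ (between⇒ a c b bc) ne , proj₂ (outside⇒ a d b od) ne)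
    cross⇒ a b c d (inj₂ (oc , bd)) | no ne = inj₁ (proj₂ (outside⇒ a c b oc) ne , proj₂ (between⇒ a d b bd) ne)

  rotate : (Fin n → ℕ) → Fin n → Fin n → ℕ
  rotate p c x with p x <? p c
  ... | yes _ = p x + suc (bound p)
  ... | no _  = p x

  module _ (p : Fin n → ℕ) (c : Fin n) where
    private
      before : Fin n → Bool
      before x = isYes (p x <? p c)

      <+shift : ∀ x y → p x < p y + suc (bound p)
      <+shift x y = ≤-trans (s≤s (≤bound p x)) (m≤n+m _ (p y))

      same-arc : ∀ x y → before x ≡ before y → rotate p c x < rotate p c y → p x < p y
      same-arc x y e lt with p x <? p c | p y <? p c
      ... | yes _ | yes _ = +-cancelʳ-< _ _ _ lt
      ... | no _  | no _  = lt
      same-arc x y () lt | yes _ | no _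
      same-arc x y () lt | no _  | yes _

      moved-first : ∀ x y → before x ≡ true → before y ≡ false → p x < p y
      moved-first x y bx by with p x <? p c | p y <? p c
      ... | yes xc | no ¬yc = <-≤-trans xc (≮⇒≥ ¬yc)
      moved-first x y () by | no _  | _
      moved-first x y bx () | yes _ | yes _

      moved-last : ∀ x y → before x ≡ true → before y ≡ false → rotate p c y < rotate p c x
      moved-last x y bx by with p x <? p c | p y <? p c
      ... | yes _ | no _ = <+shift y x
      moved-last x y () by | no _  | _
      moved-last x y bx () | yes _ | yes _

      rotate-injective : ∀ x y → rotate p c x ≡ rotate p c y → p x ≡ p y
      rotate-injective x y e with p x <? p c | p y <? p c
      ... | yes _ | yes _ = +-cancelʳ-≡ _ _ _ e
      ... | no _  | no _  = e
      ... | yes _ | no _  = contradiction (≡-sym e) (<⇒≢ (<+shift y x))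
      ... | no _  | yes _ = contradiction e (<⇒≢ (<+shift x y))

    rotate-redraws : Redraws p (rotate p c)
    rotate-redraws = rotate-injective , Rotation.cross⇒ p (rotate p c) before same-arc moved-first moved-last

    rotate-first : ∀ x → rotate p c c ≤ rotate p c x
    rotate-first x with p c <? p c
    ... | yes c<c = contradiction c<c (<-irrefl refl)
    ... | no _ with p x <? p c
    ...   | yes _  = <⇒≤ (<+shift c x)
    ...   | no ¬xc = ≮⇒≥ ¬xc

  reflect : (Fin n → ℕ) → Fin n → ℕ
  reflect p x = bound p ∸ p x

  module _ (p : Fin n → ℕ) where

    reflect-< : ∀ {x y} → p x < p y → reflect p y < reflect p x
    reflect-< {y = y} lt = ∸-monoʳ-< lt (≤bound p y)

    reflect-<⁻ : ∀ {x y} → reflect p y < reflect p x → p x < p y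
    reflect-<⁻ {x} {y} lt with p x <? p y
    ... | yes xy = xy
    ... | no ¬xy = contradiction (∸-monoʳ-≤ (bound p) (≮⇒≥ ¬xy)) (<⇒≱ lt)

    private
      reflect-injective : ∀ x y → reflect p x ≡ reflect p y → p x ≡ p y
      reflect-injective x y e with <-cmp (p x) (p y)
      ... | tri≈ _ xy _ = xy
      ... | tri< xy _ _ = contradiction (≡-sym e) (<⇒≢ (reflect-< xy))
      ... | tri> _ _ yx = contradiction e (<⇒≢ (reflect-< yx))

      between⇒ : ∀ {x y z} → Between G (reflect p) x y z → Between G p x y z
      between⇒ (inj₁ (xy , yz)) = inj₂ (reflect-<⁻ yz , reflect-<⁻ xy)
      between⇒ (inj₂ (zy , yx)) = inj₁ (reflect-<⁻ yx , reflect-<⁻ zy)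

      outside⇒ : ∀ {x y z} → Outside G (reflect p) x y z → Outside G p x y z
      outside⇒ (inj₁ (yx , yz)) = inj₂ (reflect-<⁻ yx , reflect-<⁻ yz)
      outside⇒ (inj₂ (xy , zy)) = inj₁ (reflect-<⁻ xy , reflect-<⁻ zy)

    reflect-redraws : Redraws p (reflect p)
    reflect-redraws = reflect-injective , λ where
      a b c d (inj₁ (bc , od)) → inj₁ (between⇒ bc , outside⇒ od)
      a b c d (inj₂ (oc , bd)) → inj₂ (outside⇒ oc , between⇒ bd)

-- Shortest covering chords

minimise : ∀ {A : Set} (P : A → Set) (μ : A → ℕ) → (∀ k → Dec (∃ λ x → P x × μ x < k)) →
           ∀ {x} → P x → ∃ λ x → P x × ∀ y → P y → μ x ≤ μ y
minimise {A} P μ search {x} px = go x px (<-wellFounded (μ x))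
  where
  go : ∀ x → P x → Acc _<_ (μ x) → ∃ λ x → P x × ∀ y → P y → μ x ≤ μ y
  go x px (acc smaller) with search (μ x)
  ... | yes (y , py , y<x) = go y py (smaller y<x)
  ... | no ¬smaller        = x , px , λ y py → ≮⇒≥ λ y<x → ¬smaller (y , py , y<x)

module Chords {n : ℕ} (G : Graph n) (B : Subset n) (pos : Fin n → ℕ) (inj : Injective-on G B pos) where

  Consecutive : Fin n → Fin n → Set
  Consecutive v y = ∀ w → w ∈ B → ¬ Between G pos v w y

  consecutive? : ∀ v y → Dec (Consecutive v y)
  consecutive? v y = map′ (λ h w w∈B → h w w∈B) (λ h w w∈B → h w w∈B)
    (all? λ w → (w ∈? B) →-dec ¬? (between? G pos v w y))

  Covers : Fin n → Fin n → Set
  Covers a b = IsEdgeIn G B a b × pos a < pos b × ∃ λ w → w ∈ B × pos a < pos w × pos w < pos b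

  covers? : ∀ a b → Dec (Covers a b)
  covers? a b = ((a ∈? B) ×-dec (b ∈? B) ×-dec (adj G a b ≟ᵇ true)) ×-dec (pos a <? pos b) ×-dec
    any? (λ w → (w ∈? B) ×-dec (pos a <? pos w) ×-dec (pos w <? pos b))

  span : Fin n → Fin n → ℕ
  span a b = pos b ∸ pos a

  Shortest : Fin n → Fin n → Set
  Shortest a b = Covers a b × ∀ y z → Covers y z → span a b ≤ span y z

  private
    shorter? : ∀ k → Dec (∃ λ e → uncurry Covers e × uncurry span e < k)
    shorter? k = map′ (λ (a , b , c , s) → (a , b) , c , s) (λ ((a , b) , c , s) → a , b , c , s)
      (any? λ a → any? λ b → covers? a b ×-dec (span a b <? k))

  consecutive-or-shortest : (∀ y z → IsEdgeIn G B y z → Consecutive y z) ⊎ ∃₂ Shortest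
  consecutive-or-shortest with any? (λ y → any? λ z → covers? y z)
  ... | yes (y , z , yz) with minimise (uncurry Covers) (uncurry span) shorter? yz
  ...   | (a , b) , ab , least = inj₂ (a , b , ab , λ y z → least (y , z))
  consecutive-or-shortest | no ¬covers = inj₁ λ where
    y z (y∈B , z∈B , e) w w∈B (inj₁ (yw , wz)) →
      ¬covers (y , z , (y∈B , z∈B , e) , <-trans yw wz , w , w∈B , yw , wz)
    y z (y∈B , z∈B , e) w w∈B (inj₂ (zw , wy)) →
      ¬covers (z , y , (z∈B , y∈B , trans (sym G z y) e) , <-trans zw wy , w , w∈B , zw , wy)

  -- A neighbour y in [a, b] makes vy shorter than ab, so vy covers no vertex.
  inner-neighbour : ∀ {a b v y} → Shortest a b → pos a < pos v → pos v < pos b → v ∈ B → y ∈ B →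
                    adj G v y ≡ true → Consecutive v y ⊎ Cross G pos a b v y
  inner-neighbour {a} {b} {v} {y} (_ , least) av vb v∈B y∈B e with pos y <? pos a | pos b <? pos y
  ... | yes ya | _      = inj₂ (inj₁ (inj₁ (av , vb) , inj₁ (ya , <-trans ya (<-trans av vb))))
  ... | no _   | yes by = inj₂ (inj₁ (inj₁ (av , vb) , inj₂ (<-trans (<-trans av vb) by , by)))
  ... | no ¬ya | no ¬by with <-cmp (pos v) (pos y)
  ...   | tri≈ _ vy _ = contradiction (inj v y v∈B y∈B vy) (adj⇒≢ G e)
  ...   | tri< vy _ _ = inj₁ λ where
          w w∈B (inj₁ (vw , wy)) → <⇒≱ shorter (least v y ((v∈B , y∈B , e) , vy , w , w∈B , vw , wy))
          w w∈B (inj₂ (yw , wv)) → <-asym vy (<-trans yw wv)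
    where
    shorter : span v y < span a b
    shorter = <-≤-trans (∸-monoʳ-< av (<⇒≤ vy)) (∸-monoˡ-≤ (pos a) (≮⇒≥ ¬by))
  ...   | tri> _ _ yv = inj₁ λ where
          w w∈B (inj₁ (vw , wy)) → <-asym yv (<-trans vw wy)
          w w∈B (inj₂ (yw , wv)) → <⇒≱ shorter
            (least y v ((y∈B , v∈B , trans (sym G y v) e) , yv , w , w∈B , yw , wv))
    where
    shorter : span y v < span a b
    shorter = <-≤-trans (∸-monoˡ-< vb (<⇒≤ yv)) (∸-monoʳ-≤ (pos b) (≮⇒≥ ¬ya))

  degree≤2+ : ∀ {v} → v ∈ B → (∀ y → adj G v y ≡ true → y ∈ B) → (Z : Subset n) →
              (∀ y → adj G v y ≡ true → Consecutive v y ⊎ y ∈ Z) → degree G v ≤ 2 + ∣ Z ∣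
  degree≤2+ {v} v∈B nbrs∈B Z classify = begin
    degree G v                   ≤⟨ p⊆q⇒∣p∣≤∣q∣ covered ⟩
    ∣ (Left ∪ Right) ∪ Z ∣       ≤⟨ ∣p∪q∣≤∣p∣+∣q∣ (Left ∪ Right) Z ⟩
    ∣ Left ∪ Right ∣ + ∣ Z ∣     ≤⟨ +-monoˡ-≤ ∣ Z ∣ (∣p∪q∣≤∣p∣+∣q∣ Left Right) ⟩
    ∣ Left ∣ + ∣ Right ∣ + ∣ Z ∣ ≤⟨ +-monoˡ-≤ ∣ Z ∣ (+-mono-≤ (∣p∣≤1 Left left-unique)
                                                            (∣p∣≤1 Right right-unique)) ⟩
    2 + ∣ Z ∣                    ∎
    where
    open ≤-Reasoning
    left? : ∀ y → Dec (adj G v y ≡ true × Consecutive v y × pos y < pos v)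
    left? y = (adj G v y ≟ᵇ true) ×-dec consecutive? v y ×-dec (pos y <? pos v)
    right? : ∀ y → Dec (adj G v y ≡ true × Consecutive v y × pos v < pos y)
    right? y = (adj G v y ≟ᵇ true) ×-dec consecutive? v y ×-dec (pos v <? pos y)
    Left Right : Subset n
    Left  = ⟦ left? ⟧
    Right = ⟦ right? ⟧
    left-unique : ∀ {x y} → x ∈ Left → y ∈ Left → x ≡ y
    left-unique {x} {y} x∈ y∈ with ∈⟦⟧⁻ left? x∈ | ∈⟦⟧⁻ left? y∈
    ... | ex , cx , xv | ey , cy , yv with <-cmp (pos x) (pos y)
    ...   | tri≈ _ xy _ = inj x y (nbrs∈B x ex) (nbrs∈B y ey) xy
    ...   | tri< xy _ _ = contradiction (inj₂ (xy , yv)) (cx y (nbrs∈B y ey))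
    ...   | tri> _ _ yx = contradiction (inj₂ (yx , xv)) (cy x (nbrs∈B x ex))
    right-unique : ∀ {x y} → x ∈ Right → y ∈ Right → x ≡ y
    right-unique {x} {y} x∈ y∈ with ∈⟦⟧⁻ right? x∈ | ∈⟦⟧⁻ right? y∈
    ... | ex , cx , vx | ey , cy , vy with <-cmp (pos x) (pos y)
    ...   | tri≈ _ xy _ = inj x y (nbrs∈B x ex) (nbrs∈B y ey) xy
    ...   | tri< xy _ _ = contradiction (inj₁ (vx , xy)) (cy x (nbrs∈B x ex))
    ...   | tri> _ _ yx = contradiction (inj₁ (vy , yx)) (cx y (nbrs∈B y ey))
    covered : tabulate (adj G v) ⊆ (Left ∪ Right) ∪ Z
    covered {y} y∈N with ∈tabulate⁻ (adj G v) y∈N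
    ... | e with classify y e
    ...   | inj₂ y∈Z = x∈p∪q⁺ (inj₂ y∈Z)
    ...   | inj₁ cy with <-cmp (pos y) (pos v)
    ...     | tri< yv _ _ = x∈p∪q⁺ (inj₁ (x∈p∪q⁺ (inj₁ (∈⟦⟧⁺ left? (e , cy , yv)))))
    ...     | tri> _ _ vy = x∈p∪q⁺ (inj₁ (x∈p∪q⁺ (inj₂ (∈⟦⟧⁺ right? (e , cy , vy)))))
    ...     | tri≈ _ yv _ = contradiction (inj v y v∈B (nbrs∈B y e) (≡-sym yv)) (adj⇒≢ G e)

  crossing-neighbour-unique : CrossesAtMostOnce G B pos → ∀ {a b w y y′} → IsEdgeIn G B a b →
    IsEdgeIn G B w y → IsEdgeIn G B w y′ → Cross G pos a b w y → Cross G pos a b w y′ → y ≡ y′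
  crossing-neighbour-unique once ab wy wy′ cr cr′ with once _ _ _ _ _ _ ab wy wy′ cr cr′
  ... | inj₁ (_ , y≡y′)  = y≡y′
  ... | inj₂ (_ , y≡w)   = contradiction (≡-sym y≡w) (adj⇒≢ G (proj₂ (proj₂ wy)))

-- Minimum degree

module _ {n : ℕ} (G : Graph n) where

  -- An end block of G, attached to the rest of G at its cut vertex c, is the typical example.
  Pendant : Subset n → Fin n → Set
  Pendant X c = c ∈ X × (∃ λ x → x ∈ X × x ≢ c) × (∀ u w → u ∈ X → u ≢ c → adj G u w ≡ true → w ∈ X)

  pendant-maximal : ∀ {X c} → Pendant X c → ∀ B → X ⊂ B → ¬ Nonseparable G B
  pendant-maximal {X} {c} (c∈X , (x , x∈X , x≢c) , closed) B (X⊆B , y , y∈B , y∉X) (_ , _ , cut-free) =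
    y∉X (proj₁ (walk-preserves G (λ z → z ∈ X × z ≢ c) spreads (x∈X , x≢c)
      (cut-free c (X⊆B c∈X) x y (x∈p∧x≢y⇒x∈p-y (X⊆B x∈X) x≢c) (x∈p∧x≢y⇒x∈p-y y∈B λ { refl → y∉X c∈X }))))
    where
    spreads : ∀ z w → z ∈ X × z ≢ c → adj G z w ≡ true → w ∈ B - c → w ∈ X × w ≢ c
    spreads z w (z∈X , z≢c) e w∈B-c = closed z w z∈X z≢c e , x∈p-y⇒x≢y w∈B-c

  private
    not-both-reach : ∀ {S u w} c → u ∈ S → w ∈ S → ¬ Walk G S u w → ∃ λ y → y ∈ S × ¬ Walk G S y c
    not-both-reach {S} {u} {w} c u∈S w∈S ¬uw with walk? G S u c | walk? G S w c
    ... | no ¬uc | _      = u , u∈S , ¬uc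
    ... | yes _  | no ¬wc = w , w∈S , ¬wc
    ... | yes uc | yes wc = contradiction (walk-++ G uc (walk-reverse G w∈S wc)) ¬uw

  pendant-component : ∀ {X c y} → (∀ v → ∃ λ w → adj G v w ≡ true) → Pendant X c → y ∈ X → ¬ Walk G X y c →
    ∃ λ X′ → Pendant X′ y × ∣ X′ ∣ < ∣ X ∣
  pendant-component {X} {c} {y} has-neighbour (c∈X , _ , closed) y∈X ¬yc =
    members , (contains here , (z , z∈R , λ z≡y → adj⇒≢ G yz (≡-sym z≡y)) , closed′) ,
    p⊂q⇒∣p∣<∣q∣ (R⊆X , c , c∈X , λ c∈R → ¬yc (reached c∈R))
    where
    open Component (component G X y)
    R⊆X : members ⊆ X
    R⊆X u∈R = walk-end∈ G y∈X (reached u∈R)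
    z = proj₁ (has-neighbour y)
    yz = proj₂ (has-neighbour y)
    z∈R : z ∈ members
    z∈R = contains (step yz (closed y z y∈X (λ { refl → ¬yc here }) yz) here)
    closed′ : ∀ u w → u ∈ members → u ≢ y → adj G u w ≡ true → w ∈ members
    closed′ u w u∈R _ e =
      contains (walk-snoc G (reached u∈R) e (closed u w (R⊆X u∈R) (λ { refl → ¬yc (reached u∈R) }) e))

  pendant-lobe : ∀ {X c v y t} → Pendant X c → v ∈ X → y ∈ X - v → t ∈ X - v →
    ¬ Walk G (X - v) y t → ¬ Walk G (X - v) y c → ∃ λ X′ → Pendant X′ v × ∣ X′ ∣ < ∣ X ∣
  pendant-lobe {X} {c} {v} {y} {t} (_ , _ , closed) v∈X y∈X-v t∈X-v ¬yt ¬yc =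
    members ∪ ⁅ v ⁆ , (v∈X′ , (y , x∈p∪q⁺ (inj₁ (contains here)) , x∈p-y⇒x≢y y∈X-v) , closed′) ,
    p⊂q⇒∣p∣<∣q∣ (X′⊆X , t , p─q⊆p X _ t∈X-v , t∉X′)
    where
    open Component (component G (X - v) y)
    v∈X′ : v ∈ members ∪ ⁅ v ⁆
    v∈X′ = x∈p∪q⁺ (inj₂ (x∈⁅x⁆ v))
    R⊆X-v : members ⊆ X - v
    R⊆X-v u∈R = walk-end∈ G y∈X-v (reached u∈R)
    X′⊆X : members ∪ ⁅ v ⁆ ⊆ X
    X′⊆X u∈X′ with x∈p∪q⁻ members ⁅ v ⁆ u∈X′
    ... | inj₁ u∈R   = p─q⊆p X _ (R⊆X-v u∈R)
    ... | inj₂ u∈⁅v⁆ = subst (_∈ X) (≡-sym (x∈⁅y⁆⇒x≡y v u∈⁅v⁆)) v∈X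
    t∉X′ : t ∉ members ∪ ⁅ v ⁆
    t∉X′ t∈X′ with x∈p∪q⁻ members ⁅ v ⁆ t∈X′
    ... | inj₁ t∈R   = ¬yt (reached t∈R)
    ... | inj₂ t∈⁅v⁆ = x∈p-y⇒x≢y t∈X-v (x∈⁅y⁆⇒x≡y v t∈⁅v⁆)
    closed′ : ∀ u w → u ∈ members ∪ ⁅ v ⁆ → u ≢ v → adj G u w ≡ true → w ∈ members ∪ ⁅ v ⁆
    closed′ u w u∈X′ u≢v e with x∈p∪q⁻ members ⁅ v ⁆ u∈X′ | w ≟ᶠ v
    ... | inj₂ u∈⁅v⁆ | _       = contradiction (x∈⁅y⁆⇒x≡y v u∈⁅v⁆) u≢v
    ... | inj₁ _    | yes refl = v∈X′
    ... | inj₁ u∈R  | no w≢v   = x∈p∪q⁺ (inj₁ (contains (walk-snoc G (reached u∈R) e w∈X-v)))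
      where
      w∈X-v : w ∈ X - v
      w∈X-v = x∈p∧x≢y⇒x∈p-y (closed u w (p─q⊆p X _ (R⊆X-v u∈R)) (λ { refl → ¬yc (reached u∈R) }) e) w≢v

  pendant-block : (∀ v → ∃ λ w → adj G v w ≡ true) → ∀ {X c} → Pendant X c →
    ∃₂ λ Y d → Pendant Y d × IsBlock G Y
  pendant-block has-neighbour {X} {c} P = go X c P (<-wellFounded ∣ X ∣)
    where
    go : ∀ X c → Pendant X c → Acc _<_ ∣ X ∣ → ∃₂ λ Y d → Pendant Y d × IsBlock G Y
    go X c P@(c∈X , _) (acc smaller) with separated? G X
    ... | yes (u , w , u∈X , w∈X , ¬uw) =
      let y , y∈X , ¬yc = not-both-reach c u∈X w∈X ¬uw
          X′ , P′ , X′<X = pendant-component has-neighbour P y∈X ¬yc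
      in go X′ y P′ (smaller X′<X)
    ... | no ¬separated with any? (λ v → (v ∈? X) ×-dec separated? G (X - v))
    ...   | yes (v , v∈X , u , w , u∈X-v , w∈X-v , ¬uw) with c ≟ᶠ v
    ...     | yes refl =
      let X′ , P′ , X′<X = pendant-lobe P v∈X u∈X-v w∈X-v ¬uw
                             (λ uc → x∈p-y⇒x≢y (walk-end∈ G u∈X-v uc) refl)
      in go X′ v P′ (smaller X′<X)
    ...     | no c≢v =
      let y , y∈X-v , ¬yc = not-both-reach c u∈X-v w∈X-v ¬uw
          X′ , P′ , X′<X = pendant-lobe P v∈X y∈X-v (x∈p∧x≢y⇒x∈p-y c∈X c≢v) ¬yc ¬yc
      in go X′ v P′ (smaller X′<X)
    go X c P@(c∈X , (x , x∈X , x≢c) , _) (acc smaller) | no ¬separated | no ¬cut =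
      X , c , P ,
      (x≢y⇒2≤∣p∣ x∈X c∈X x≢c , ¬separated⇒connected G ¬separated ,
       (λ v v∈X → ¬separated⇒connected G λ sep → ¬cut (v , v∈X , sep))) ,
      pendant-maximal P

  pendant-drawing-degree≤3 : ∀ {X c} (pos : Fin n → ℕ) → Pendant X c → Injective-on G X pos →
    CrossesAtMostOnce G X pos → (∀ x → pos c ≤ pos x) → ∃ λ v → degree G v ≤ 3
  pendant-drawing-degree≤3 {X} {c} pos (c∈X , (x , x∈X , x≢c) , closed) inj once c-first
    with Chords.consecutive-or-shortest G X pos inj
  ... | inj₁ all-consecutive = x , ≤-trans (degree≤2+ x∈X (nbrs∈X x∈X x≢c) ∅ λ y e →
          inj₁ (all-consecutive x y (x∈X , nbrs∈X x∈X x≢c y e , e)))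
          (≤-trans (≤-reflexive (cong (2 +_) (∣⊥∣≡0 n))) (n≤1+n 2))
    where
    open Chords G X pos inj
    nbrs∈X : ∀ {u} → u ∈ X → u ≢ c → ∀ y → adj G u y ≡ true → y ∈ X
    nbrs∈X u∈X u≢c y = closed _ y u∈X u≢c
  ... | inj₂ (a , b , shortest@(((a∈X , b∈X , ab) , _ , w , w∈X , aw , wb) , _)) =
    w , ≤-trans (degree≤2+ w∈X nbrs∈X Crossing classify) (+-monoʳ-≤ 2 (∣p∣≤1 Crossing crossing-unique))
    where
    open Chords G X pos inj
    w≢c : w ≢ c
    w≢c refl = <-irrefl refl (<-≤-trans aw (c-first a))
    nbrs∈X : ∀ y → adj G w y ≡ true → y ∈ X
    nbrs∈X y = closed w y w∈X w≢c
    crossing? : ∀ y → Dec (adj G w y ≡ true × Cross G pos a b w y)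
    crossing? y = (adj G w y ≟ᵇ true) ×-dec cross? G pos a b w y
    Crossing : Subset n
    Crossing = ⟦ crossing? ⟧
    crossing-unique : ∀ {y y′} → y ∈ Crossing → y′ ∈ Crossing → y ≡ y′
    crossing-unique y∈ y′∈ with ∈⟦⟧⁻ crossing? y∈ | ∈⟦⟧⁻ crossing? y′∈
    ... | e , cr | e′ , cr′ = crossing-neighbour-unique once (a∈X , b∈X , ab)
            (w∈X , nbrs∈X _ e , e) (w∈X , nbrs∈X _ e′ , e′) cr cr′
    classify : ∀ y → adj G w y ≡ true → Consecutive w y ⊎ y ∈ Crossing
    classify y e with inner-neighbour shortest aw wb w∈X (nbrs∈X y e) e
    ... | inj₁ consecutive = inj₁ consecutive
    ... | inj₂ cr          = inj₂ (∈⟦⟧⁺ crossing? (e , cr))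

  pendant-block-degree≤3 : PseudoOuterplanar G → ∀ {X c} → Pendant X c → IsBlock G X → ∃ λ v → degree G v ≤ 3
  pendant-block-degree≤3 po {X} {c} P block with po X block
  ... | pos , drawing =
    let inj , once = redraw G (rotate-redraws G pos c) drawing
    in pendant-drawing-degree≤3 (rotate G pos c) P inj once (rotate-first G pos c)

  minimum-degree≤3 : 1 ≤ n → PseudoOuterplanar G → MinDegree≤ G 3
  minimum-degree≤3 1≤n po with any? (λ v → degree G v ≤? 3)
  ... | yes small = small
  ... | no ¬small =
    let _ , _ , P , block = pendant-block has-neighbour whole in pendant-block-degree≤3 po P block
    where
    has-neighbour : ∀ v → ∃ λ w → adj G v w ≡ true
    has-neighbour v with 1≤∣p∣⇒nonempty (tabulate (adj G v)) (≤-trans (s≤s z≤n) (≰⇒> λ small → ¬small (v , small)))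
    ... | w , w∈N = w , ∈tabulate⁻ (adj G v) w∈N
    whole : Pendant ⊤ (fromℕ< 1≤n)
    whole = ∈⊤ , (proj₁ (has-neighbour _) , ∈⊤ , λ eq → adj⇒≢ G (proj₂ (has-neighbour _)) (≡-sym eq)) , λ _ _ _ _ _ → ∈⊤

-- Connectivity

module _ {n : ℕ} (G : Graph n) where

  ThreeConnected : Set
  ThreeConnected = ∀ S → ∣ S ∣ ≤ 2 → Connected G (∁ S)

  separating-property : ∀ {S u w} → ∣ S ∣ ≤ 2 → u ∈ ∁ S → w ∈ ∁ S → (P : Fin n → Set) →
    (∀ z y → P z → adj G z y ≡ true → y ∈ ∁ S → P y) → P u → ¬ P w → ¬ ThreeConnected
  separating-property {S} {u} {w} ∣S∣≤2 u∈ w∈ P spreads pu ¬pw tc =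
    ¬pw (walk-preserves G P spreads pu (tc S ∣S∣≤2 u w u∈ w∈))

  three-connected⇒2<degree : 4 ≤ n → ThreeConnected → ∀ v → 2 < degree G v
  three-connected⇒2<degree 4≤n tc v = ≰⇒> λ deg≤2 →
    let w , w∈ , w≢v = 2≤∣p∣⇒∃≢ (∁ N) v (2≤∣∁N∣ deg≤2)
    in separating-property deg≤2 v∈ w∈ (_≡ v) spreads refl w≢v tc
    where
    N = tabulate (adj G v)
    2≤∣∁N∣ : degree G v ≤ 2 → 2 ≤ ∣ ∁ N ∣
    2≤∣∁N∣ deg≤2 = begin
      2          ≤⟨ ∸-monoˡ-≤ 2 4≤n ⟩
      n ∸ 2      ≤⟨ ∸-monoʳ-≤ n deg≤2 ⟩
      n ∸ ∣ N ∣  ≡⟨ ∣∁p∣≡n∸∣p∣ N ⟨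
      ∣ ∁ N ∣    ∎
      where open ≤-Reasoning
    v∈ : v ∈ ∁ N
    v∈ = x∉p⇒x∈∁p λ v∈N → adj⇒≢ G (∈tabulate⁻ (adj G v) v∈N) refl
    spreads : ∀ z y → z ≡ v → adj G z y ≡ true → y ∈ ∁ N → y ≡ v
    spreads z y refl e y∈ = contradiction (∈tabulate⁺ (adj G v) e) (x∈∁p⇒x∉p y∈)

  module _ (pos : Fin n → ℕ) where

    apart : ∀ {x y} → pos x < pos y → x ≢ y
    apart lt refl = <-irrefl refl lt

    -- Either an inner vertex of the arc from b to x is cut off by {b, x}, or that arc is
    -- empty and {a, x} cuts {v, b} off from any fifth vertex.
    module SeparatingPair (inj : ∀ x y → pos x ≡ pos y → x ≡ y) {a v b x : Fin n}
      (av : pos a < pos v) (vb : pos v < pos b) (bx : pos b < pos x)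
      (only-ab : ∀ k w → adj G k w ≡ true → Cross G pos v x k w → SameEdge G a b k w)
      (inner-v : ∀ y → pos a < pos y → pos y < pos b → y ≡ v)
      (nbrs-v : ∀ y → adj G v y ≡ true → y ≡ a ⊎ y ≡ b ⊎ y ≡ x) where

      arc-vertex-cut-off : ∀ {k} → pos b < pos k → pos k < pos x → ¬ ThreeConnected
      arc-vertex-cut-off bk kx =
        separating-property (∣⁅x⁆∪⁅y⁆∣≤2 b x) (x∈∁⁅y⁆∪⁅z⁆⁺ (apart bk ∘ ≡-sym) (apart kx))
          (x∈∁⁅y⁆∪⁅z⁆⁺ (apart vb) (apart (<-trans vb bx)))
          Inside spreads (bk , kx) (λ (bv , _) → <-asym bv vb)
        where
        Inside : Fin n → Set
        Inside z = pos b < pos z × pos z < pos x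
        not-crossing : ∀ {z y} → Inside z → adj G z y ≡ true → ¬ Cross G pos v x z y
        not-crossing {z} (bz , _) e cr with only-ab z _ e cr
        ... | inj₁ (a≡z , _) = apart (<-trans (<-trans av vb) bz) a≡z
        ... | inj₂ (_ , b≡z) = apart bz b≡z
        spreads : ∀ z y → Inside z → adj G z y ≡ true → y ∈ ∁ (⁅ b ⁆ ∪ ⁅ x ⁆) → Inside y
        spreads z y in-z@(bz , zx) e y∈ with x∈∁⁅y⁆∪⁅z⁆⁻ y∈ | <-cmp (pos y) (pos b)
        ... | y≢b , _ | tri≈ _ yb _ = contradiction (inj y b yb) y≢b
        ... | _ , y≢x | tri> _ _ by with <-cmp (pos y) (pos x)
        ...   | tri< yx _ _ = by , yx
        ...   | tri≈ _ yx _ = contradiction (inj y x yx) y≢x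
        ...   | tri> _ _ xy = contradiction
                                (inj₁ (inj₁ (<-trans vb bz , zx) , inj₂ (<-trans (<-trans vb bz) (<-trans zx xy) , xy)))
                                (not-crossing in-z e)
        spreads z y in-z@(bz , zx) e y∈ | _ | tri< yb _ _ with <-cmp (pos y) (pos v)
        ...   | tri< yv _ _ = contradiction (inj₁ (inj₁ (<-trans vb bz , zx) , inj₁ (yv , <-trans yb bx)))
                                (not-crossing in-z e)
        ...   | tri> _ _ vy = contradiction (≡-sym (inner-v y (<-trans av vy) yb)) (apart vy)
        ...   | tri≈ _ yv _ with nbrs-v z (trans (sym G v z) (subst (λ t → adj G z t ≡ true) (inj y v yv) e))
        ...     | inj₁ z≡a        = contradiction (≡-sym z≡a) (apart (<-trans (<-trans av vb) bz))
        ...     | inj₂ (inj₁ z≡b) = contradiction (≡-sym z≡b) (apart bz)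
        ...     | inj₂ (inj₂ z≡x) = contradiction z≡x (apart zx)

      empty-arc-cut-off : 5 ≤ n → (∀ k → ¬ (pos b < pos k × pos k < pos x)) → ¬ ThreeConnected
      empty-arc-cut-off 5≤n arc-empty =
        let w , w≢a , w≢v , w≢b , w≢x = fifth-vertex 5≤n a v b x
        in separating-property (∣⁅x⁆∪⁅y⁆∣≤2 a x) (x∈∁⁅y⁆∪⁅z⁆⁺ (apart av ∘ ≡-sym) (apart (<-trans vb bx)))
             (x∈∁⁅y⁆∪⁅z⁆⁺ w≢a w≢x) VB spreads (inj₁ refl) [ w≢v , w≢b ]′
        where
        VB : Fin n → Set
        VB z = z ≡ v ⊎ z ≡ b
        not-crossing : ∀ {y} → y ≢ a → adj G b y ≡ true → ¬ Cross G pos v x b y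
        not-crossing y≢a e cr with only-ab b _ e cr
        ... | inj₁ (a≡b , _) = apart (<-trans av vb) a≡b
        ... | inj₂ (a≡y , _) = y≢a (≡-sym a≡y)
        spreads : ∀ z y → VB z → adj G z y ≡ true → y ∈ ∁ (⁅ a ⁆ ∪ ⁅ x ⁆) → VB y
        spreads z y (inj₁ refl) e y∈ with nbrs-v y e
        ... | inj₁ y≡a        = contradiction y≡a (proj₁ (x∈∁⁅y⁆∪⁅z⁆⁻ y∈))
        ... | inj₂ (inj₁ y≡b) = inj₂ y≡b
        ... | inj₂ (inj₂ y≡x) = contradiction y≡x (proj₂ (x∈∁⁅y⁆∪⁅z⁆⁻ y∈))
        spreads z y (inj₂ refl) e y∈ with x∈∁⁅y⁆∪⁅z⁆⁻ y∈ | <-cmp (pos y) (pos a)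
        ... | y≢a , _ | tri< ya _ _ =
          contradiction (inj₁ (inj₁ (vb , bx) , inj₁ (<-trans ya av , <-trans ya (<-trans av (<-trans vb bx)))))
            (not-crossing y≢a e)
        ... | y≢a , _ | tri≈ _ ya _ = contradiction (inj y a ya) y≢a
        ... | y≢a , y≢x | tri> _ _ ay with <-cmp (pos y) (pos b)
        ...   | tri< yb _ _ = inj₁ (inner-v y ay yb)
        ...   | tri≈ _ yb _ = inj₂ (inj y b yb)
        ...   | tri> _ _ by with <-cmp (pos y) (pos x)
        ...     | tri< yx _ _ = contradiction (by , yx) (arc-empty y)
        ...     | tri≈ _ yx _ = contradiction (inj y x yx) y≢x
        ...     | tri> _ _ xy = contradiction (inj₁ (inj₁ (vb , bx) , inj₂ (<-trans vb by , xy))) (not-crossing y≢a e)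

      separated-by-two : 5 ≤ n → ¬ ThreeConnected
      separated-by-two 5≤n with any? (λ k → (pos b <? pos k) ×-dec (pos k <? pos x))
      ... | yes (k , bk , kx) = arc-vertex-cut-off bk kx
      ... | no arc-empty      = empty-arc-cut-off 5≤n λ k bkx → arc-empty (k , bkx)

module ThreeConnectedDrawing {n : ℕ} (G : Graph n) (5≤n : 5 ≤ n) (tc : ThreeConnected G)
  (pos : Fin n → ℕ) (inj : Injective-on G ⊤ pos) (once : CrossesAtMostOnce G ⊤ pos) where

  open Chords G ⊤ pos inj

  pos-injective : ∀ x y → pos x ≡ pos y → x ≡ y
  pos-injective x y = inj x y ∈⊤ ∈⊤

  crossing-edges-coincide : ∀ {a b c d c′ d′} → adj G a b ≡ true → adj G c d ≡ true → adj G c′ d′ ≡ true →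
    Cross G pos a b c d → Cross G pos a b c′ d′ → SameEdge G c d c′ d′
  crossing-edges-coincide ab cd cd′ = once _ _ _ _ _ _ (∈⊤ , ∈⊤ , ab) (∈⊤ , ∈⊤ , cd) (∈⊤ , ∈⊤ , cd′)

  not-all-consecutive : ∀ v → ¬ (∀ y → adj G v y ≡ true → Consecutive v y)
  not-all-consecutive v consecutive = <⇒≱ (three-connected⇒2<degree G (≤-trans (n≤1+n 4) 5≤n) tc v)
    (≤-trans (degree≤2+ ∈⊤ (λ _ _ → ∈⊤) ∅ λ y e → inj₁ (consecutive y e)) (≤-reflexive (cong (2 +_) (∣⊥∣≡0 n))))

  module _ {a b w} (ab : adj G a b ≡ true) (aw : pos a < pos w) (wb : pos w < pos b) (shortest : Shortest a b) where

    crossing-neighbour : ∀ {z} → pos a < pos z → pos z < pos b → ∃ λ y → adj G z y ≡ true × Cross G pos a b z y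
    crossing-neighbour {z} az zb with any? (λ y → (adj G z y ≟ᵇ true) ×-dec cross? G pos a b z y)
    ... | yes found = found
    ... | no none   = ⊥-elim (not-all-consecutive z λ y e →
          [ (λ consecutive → consecutive) , (λ cr → ⊥-elim (none (y , e , cr))) ]′
            (inner-neighbour shortest az zb ∈⊤ ∈⊤ e))

    x : Fin n
    x = proj₁ (crossing-neighbour aw wb)

    wx : adj G w x ≡ true
    wx = proj₁ (proj₂ (crossing-neighbour aw wb))

    wx-crosses : Cross G pos a b w x
    wx-crosses = proj₂ (proj₂ (crossing-neighbour aw wb))

    x-outside : Outside G pos a x b
    x-outside with wx-crosses
    ... | inj₁ (_ , x-out)  = x-out
    ... | inj₂ (w-out , _)  = ⊥-elim (¬between×outside G {p = pos} (inj₁ (aw , wb)) w-out)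

    inner-unique : ∀ y → pos a < pos y → pos y < pos b → y ≡ w
    inner-unique y ay yb with crossing-neighbour ay yb
    ... | y′ , yy′ , cr with crossing-edges-coincide ab yy′ wx cr wx-crosses
    ...   | inj₁ (y≡w , _) = y≡w
    ...   | inj₂ (y≡x , _) = ⊥-elim (¬between×outside G {p = pos} (inj₁ (ay , yb))
                                  (subst (λ t → Outside G pos a t b) (≡-sym y≡x) x-outside))

    w-neighbours : ∀ y → adj G w y ≡ true → y ≡ a ⊎ y ≡ b ⊎ y ≡ x
    w-neighbours y e with inner-neighbour shortest aw wb ∈⊤ ∈⊤ e
    ... | inj₂ cr = inj₂ (inj₂ (≡-sym (crossing-neighbour-unique once
                      (∈⊤ , ∈⊤ , ab) (∈⊤ , ∈⊤ , wx) (∈⊤ , ∈⊤ , e) wx-crosses cr)))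
    ... | inj₁ consecutive with <-cmp (pos y) (pos a)
    ...   | tri< ya _ _ = ⊥-elim (consecutive a ∈⊤ (inj₂ (ya , aw)))
    ...   | tri≈ _ ya _ = inj₁ (pos-injective y a ya)
    ...   | tri> _ _ ay with <-cmp (pos y) (pos b)
    ...     | tri< yb _ _ = ⊥-elim (adj⇒≢ G e (≡-sym (inner-unique y ay yb)))
    ...     | tri≈ _ yb _ = inj₂ (inj₁ (pos-injective y b yb))
    ...     | tri> _ _ by = ⊥-elim (consecutive b ∈⊤ (inj₁ (wb , by)))

    crosses-wx-only-ab : ∀ k z → adj G k z ≡ true → Cross G pos w x k z → SameEdge G a b k z
    crosses-wx-only-ab k z e cr = crossing-edges-coincide wx ab e ab-crosses cr
      where
      ab-crosses : Cross G pos w x a b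
      ab-crosses with x-outside
      ... | inj₁ (xa , xb) = inj₁ (inj₂ (xa , aw) , inj₂ (wb , xb))
      ... | inj₂ (ax , bx) = inj₂ (inj₁ (aw , ax) , inj₁ (wb , bx))

    -- After reflecting the drawing if necessary, x lies beyond b.
    shortest-chord-impossible : ⊥
    shortest-chord-impossible with x-outside
    ... | inj₂ (_ , bx) =
      SeparatingPair.separated-by-two G pos pos-injective aw wb bx crosses-wx-only-ab inner-unique w-neighbours 5≤n tc
    ... | inj₁ (xa , _) = SeparatingPair.separated-by-two G (reflect G pos)
            (λ y z e → pos-injective y z (proj₁ (reflect-redraws G pos) y z e))
            (reflect-< G pos wb) (reflect-< G pos aw) (reflect-< G pos xa)
            (λ k z e cr → SameEdge-swap G (crosses-wx-only-ab k z e (proj₂ (reflect-redraws G pos) w x k z cr)))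
            (λ y by ya → inner-unique y (reflect-<⁻ G pos ya) (reflect-<⁻ G pos by))
            (λ y e → [ inj₂ ∘ inj₁ , [ inj₁ , inj₂ ∘ inj₂ ]′ ]′ (w-neighbours y e))
            5≤n tc

  impossible : ⊥
  impossible with consecutive-or-shortest
  ... | inj₁ all-consecutive = not-all-consecutive v (λ y e → all-consecutive v y (∈⊤ , ∈⊤ , e))
    where
    v : Fin n
    v = fromℕ< (≤-trans (s≤s z≤n) 5≤n)
  ... | inj₂ (a , b , shortest@(((_ , _ , ab) , _ , w , _ , aw , wb) , _)) = shortest-chord-impossible ab aw wb shortest

module _ {n : ℕ} (G : Graph n) where

  three-connected⇒block : 2 ≤ n → ThreeConnected G → IsBlock G ⊤
  three-connected⇒block 2≤n tc =
    (subst (2 ≤_) (≡-sym (∣⊤∣≡n n)) 2≤n , connected , cut-free) , λ { B (_ , x , _ , x∉⊤) _ → x∉⊤ ∈⊤ }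
    where
    connected : Connected G ⊤
    connected u w _ _ = walk-mono G (λ _ → ∈⊤)
      (tc ∅ (≤-trans (≤-reflexive (∣⊥∣≡0 n)) z≤n) u w (x∉p⇒x∈∁p ∉⊥) (x∉p⇒x∈∁p ∉⊥))
    cut-free : ∀ v → v ∈ ⊤ → Connected G (⊤ - v)
    cut-free v _ u w u∈ w∈ = walk-mono G (λ y∈ → x∈p∧x≢y⇒x∈p-y ∈⊤ (x∉⁅y⁆⇒x≢y (x∈∁p⇒x∉p y∈)))
      (tc ⁅ v ⁆ (≤-trans (≤-reflexive (∣⁅x⁆∣≡1 v)) (s≤s z≤n)) u w
        (x∉p⇒x∈∁p (x≢y⇒x∉⁅y⁆ (x∈p-y⇒x≢y u∈))) (x∉p⇒x∈∁p (x≢y⇒x∉⁅y⁆ (x∈p-y⇒x≢y w∈))))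

  ¬three-connected⇒connectivity≤2 : ¬ ThreeConnected G → Connectivity≤ G 2
  ¬three-connected⇒connectivity≤2 ¬tc with anySubset? (λ S → (∣ S ∣ ≤? 2) ×-dec ¬? (connected? G (∁ S)))
  ... | yes (S , ∣S∣≤2 , ¬connected) = S , ∣S∣≤2 , inj₁ ¬connected
  ... | no ¬separator = ⊥-elim (¬tc λ S ∣S∣≤2 →
          decidable-stable (connected? G (∁ S)) λ ¬connected → ¬separator (S , ∣S∣≤2 , ¬connected))

  pseudo-outerplanar⇒¬three-connected : 5 ≤ n → PseudoOuterplanar G → ¬ ThreeConnected G
  pseudo-outerplanar⇒¬three-connected 5≤n po tc with po ⊤ (three-connected⇒block (≤-trans (s≤s (s≤s z≤n)) 5≤n) tc)
  ... | pos , inj , once = ThreeConnectedDrawing.impossible G 5≤n tc pos inj once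

three-connected⇒K4 : (G : Graph 4) → ThreeConnected G → G ≅ K4
three-connected⇒K4 G tc = ⤖-id (Fin 4) , adj≡
  where
  adjacent : ∀ u v → u ≢ v → adj G u v ≡ true
  adjacent u v u≢v with adj G u v in uv
  ... | true  = refl
  ... | false = ⊥-elim (separating-property G ∣∁pair∣≤2 (∈pair u∈) (∈pair v∈) (_≡ u) spreads refl (u≢v ∘ ≡-sym) tc)
    where
    uv-pair = ⁅ u ⁆ ∪ ⁅ v ⁆
    u∈ : u ∈ uv-pair
    u∈ = x∈p∪q⁺ (inj₁ (x∈⁅x⁆ u))
    v∈ : v ∈ uv-pair
    v∈ = x∈p∪q⁺ (inj₂ (x∈⁅x⁆ v))
    ∣∁pair∣≤2 : ∣ ∁ uv-pair ∣ ≤ 2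
    ∣∁pair∣≤2 = ≤-trans (≤-reflexive (∣∁p∣≡n∸∣p∣ uv-pair)) (∸-monoʳ-≤ 4 (x≢y⇒2≤∣p∣ u∈ v∈ u≢v))
    ∈pair : ∀ {x} → x ∈ uv-pair → x ∈ ∁ (∁ uv-pair)
    ∈pair x∈ = x∉p⇒x∈∁p (x∈p⇒x∉∁p x∈)
    spreads : ∀ z y → z ≡ u → adj G z y ≡ true → y ∈ ∁ (∁ uv-pair) → y ≡ u
    spreads z y refl zy y∈ with x∈p∪q⁻ ⁅ u ⁆ ⁅ v ⁆ (x∉∁p⇒x∈p (x∈∁p⇒x∉p y∈))
    ... | inj₁ y∈⁅u⁆ = x∈⁅y⁆⇒x≡y u y∈⁅u⁆
    ... | inj₂ y∈⁅v⁆ with trans (≡-sym uv) (subst (λ t → adj G z t ≡ true) (x∈⁅y⁆⇒x≡y v y∈⁅v⁆) zy)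
    ...   | ()
  adj≡ : ∀ u v → adj G u v ≡ adj K4 u v
  adj≡ u v with u ≟ᶠ v
  ... | yes refl = irrefl G u
  ... | no u≢v   = adjacent u v u≢v

connectivity≤2 : ∀ n (G : Graph n) → 1 ≤ n → PseudoOuterplanar G → ¬ (G ≅ K4) → Connectivity≤ G 2
connectivity≤2 1 G _ _ _ = (false ∷ []) , z≤n , inj₂ (s≤s z≤n)
connectivity≤2 2 G _ _ _ = (true ∷ false ∷ []) , s≤s z≤n , inj₂ (s≤s z≤n)
connectivity≤2 3 G _ _ _ = (true ∷ true ∷ false ∷ []) , s≤s (s≤s z≤n) , inj₂ (s≤s z≤n)
connectivity≤2 4 G _ _ ¬K4 = ¬three-connected⇒connectivity≤2 G (¬K4 ∘ three-connected⇒K4 G)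
connectivity≤2 (suc (suc (suc (suc (suc k))))) G _ po _ =
  ¬three-connected⇒connectivity≤2 G (pseudo-outerplanar⇒¬three-connected G (s≤s (s≤s (s≤s (s≤s (s≤s z≤n))))) po)

theorem2p2 : (n : ℕ) (G : Graph n) → 1 ≤ n → PseudoOuterplanar G →
    MinDegree≤ G 3 × (¬ (G ≅ K4) → Connectivity≤ G 2)
theorem2p2 n G 1≤n po = minimum-degree≤3 G 1≤n po , connectivity≤2 n G 1≤n po
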